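{- Let $k\ge 2$ and let $T$ be a $k$-cut search tree on a tree $S$. Let $q$ be a node of $T$ with parent $p$ such that $|\delta(T_q)|=k$ and $|\delta(T_p)|=k-1$. Then rotating at $q$ produces a $k$-cut search tree $T'$ with $|\delta(T'_q)|\le k-1$ and $|\delta(T'_x)|\le|\delta(T_x)|$ for every node $x\in V(T)\setminus\{q\}$.
   Context: A search tree on an unrooted tree $S$ (STT) is a rooted tree $T$ with $V(T)=V(S)$ defined recursively: the root $r$ is any node of $S$, and the subtrees of $T$ rooted at the children of $r$ are search trees on the connected components of $S\setminus r$. $T_x$ is the subtree of $T$ rooted at $x$ and $\delta(T_x)$ is the set of nodes outside $V(T_x)$ adjacent in $S$ to a node of $V(T_x)$. $T$ is a $k$-cut tree if $|\delta(T_x)|\le k$ for all $x$. A rotation at a node $q$ with parent $p$: $q$ and $p$ swap places; if $q$ has a child $y$ whose subtree contains a node adjacent to $p$ in $S$, then $y$ becomes a child of $p$; all other children keep their parents. -}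

module Defs where

open import Data.Nat using (ℕ; zero; suc; _≤_; _∸_; _+_)
open import Data.Fin using (Fin; _≟_)
open import Data.Bool using (Bool; true; false; _∧_; _∨_; not; if_then_else_)
open import Data.Maybe using (Maybe; just; nothing; _>>=_)
open import Data.List using (List; []; _∷_; length; filterᵇ; upTo; allFin)
open import Data.Bool.ListAction using (any)
open import Data.Vec using (Vec; []; _∷_; head; last; toList)
open import Data.List.Relation.Unary.Unique.Propositional using (Unique)
open import Data.Product using (Σ; _×_; ∃)
open import Relation.Binary.PropositionalEquality using (_≡_)
open import Relation.Nullary using (¬_)
open import Relation.Nullary.Decidable using (⌊_⌋)

-- The unrooted tree S on vertex set Fin n, given by a Bool adjacency
-- matrix.

module _ {n : ℕ} (Adj : Fin n → Fin n → Bool) where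

  data WalkIn (W : Fin n → Bool) : Fin n → Fin n → Set where
    here  : ∀ {a} → W a ≡ true → WalkIn W a a
    step  : ∀ {a c b} → W a ≡ true → Adj a c ≡ true → WalkIn W c b → WalkIn W a b

  ConnectedIn : (Fin n → Bool) → Set
  ConnectedIn W = ∀ a b → W a ≡ true → W b ≡ true → WalkIn W a b

  PathAdj : List (Fin n) → Set
  PathAdj []            = Data.Unit.⊤ where import Data.Unit
  PathAdj (x ∷ [])      = Data.Unit.⊤ where import Data.Unit
  PathAdj (x ∷ y ∷ xs)  = (Adj x y ≡ true) × PathAdj (y ∷ xs)

  Cycle : Set
  Cycle = Σ ℕ λ m → Σ (Vec (Fin n) (suc (suc (suc m)))) λ vs →
            Unique (toList vs) × PathAdj (toList vs) × (Adj (last vs) (head vs) ≡ true)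

  IsTree : Set
  IsTree = (∀ a b → Adj a b ≡ Adj b a)
         × (∀ a → Adj a a ≡ false)
         × ConnectedIn (λ _ → true)
         × ¬ Cycle

-- Rooted trees T on Fin n given by a parent function
-- (par x ≡ nothing iff x is the root).

Parent : ℕ → Set
Parent n = Fin n → Maybe (Fin n)

module _ {n : ℕ} where

  eqᴹ : Maybe (Fin n) → Fin n → Bool
  eqᴹ (just a) b = ⌊ a ≟ b ⌋
  eqᴹ nothing  b = false

  iter : Parent n → ℕ → Fin n → Maybe (Fin n)
  iter par zero    y = just y
  iter par (suc i) y = iter par i y >>= par

  -- inT par x y = true  iff  y ∈ V(T_x), i.e. x is an ancestor of y
  -- (including x itself).  In a rooted tree on n nodes the depth is < n,
  -- so it suffices to look at the first n+1 iterates.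
  inT : Parent n → Fin n → Fin n → Bool
  inT par x y = any (λ i → eqᴹ (iter par i y) x) (upTo (suc n))

  IsRootedTree : Parent n → Set
  IsRootedTree par = Σ (Fin n) λ r → (par r ≡ nothing)
                   × (∀ x → par x ≡ nothing → x ≡ r)
                   × (∀ x → Σ ℕ λ i → iter par i x ≡ just r)

module _ {n : ℕ} (Adj : Fin n → Fin n → Bool) where

  count : (Fin n → Bool) → ℕ
  count f = length (filterᵇ f (allFin n))

  δ : Parent n → Fin n → Fin n → Bool
  δ par x v = not (inT par x v) ∧ any (λ u → inT par x u ∧ Adj u v) (allFin n)

  ∣δ∣ : Parent n → Fin n → ℕ
  ∣δ∣ par x = count (δ par x)

  -- Search tree on S (unfolding of the recursive definition): T is a
  -- rooted tree on V(S) and for every node x and every child c of x,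
  -- V(T_c) is a connected component of S[V(T_x) ∖ {x}], i.e. S[V(T_c)] is
  -- connected and there is no S-edge between V(T_c) and the rest of
  -- V(T_x) ∖ {x}.  (V(T_c) ⊆ V(T_x) ∖ {x}, and the children's subtrees
  -- partition V(T_x) ∖ {x}, hold automatically in a rooted tree.)
  IsSTT : Parent n → Set
  IsSTT par = IsRootedTree par
            × (∀ x c → par c ≡ just x →
                 ConnectedIn Adj (inT par c)
               × (∀ u v → inT par c u ≡ true → inT par x v ≡ true →
                    ¬ (v ≡ x) → inT par c v ≡ false → Adj u v ≡ false))

  IsKCut : Parent n → ℕ → Set
  IsKCut par k = ∀ x → ∣δ∣ par x ≤ k

  -- rotation at q whose parent is p: q takes p's place, p becomes a child
  -- of q, the child y of q whose subtree contains a node adjacent to p in S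
  -- becomes a child of p, everything else keeps its parent.
  rotate : Parent n → (q p : Fin n) → Parent n
  rotate par q p y =
    if ⌊ y ≟ q ⌋ then par p
    else if ⌊ y ≟ p ⌋ then just q
    else if eqᴹ (par y) q ∧ any (λ z → inT par y z ∧ Adj z p) (allFin n)
      then just p
    else par y

-- Rotating at q changes only two subtrees: V(T′_q) = V(T_p), and V(T′_p) consists of
-- V(T_p) ∖ V(T_q) together with V(T_y) for the (unique) child y of q whose subtree has a
-- neighbour of p, if there is one.  Every condition of a search tree for T′ is then one of T.
-- Hence δ(T′_q) = δ(T_p), δ(T′_x) = δ(T_x) for x ∉ {p, q}, and only δ(T′_p) needs an argument.
-- Since δ(T_q) ∖ {p} ⊆ δ(T_p), the sizes k and k − 1 force δ(T_p) ⊆ δ(T_q).  As S is a tree,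
-- a vertex outside the connected set V(T_p) has at most one neighbour in it; so each vertex of
-- δ(T′_p) other than q has its neighbour in V(T_y) and lies in δ(T_y).  Since p, q ∈ δ(T_y),
-- this gives |δ(T′_p)| ≤ |δ(T_y)| − 1 ≤ k − 1 (and |δ(T′_p)| ≤ 1 if y does not exist).

module Submission where

open import Defs
open import Data.Nat using (ℕ; zero; suc; _≤_; _<_; _∸_; _+_; z≤n; s≤s)
open import Data.Nat.Properties
  using (≤-trans; ≤-reflexive; ≤-pred; <⇒≤; +-comm; +-suc; +-monoˡ-≤; m≤n⇒m≤1+n; n<1+n; <-irrefl; ≰⇒>; _≤?_;
         m≤n⇒∃[o]m+o≡n; module ≤-Reasoning)
open import Data.Fin using (Fin; _≟_; toℕ)
open import Data.Fin.Properties using (pigeonhole; toℕ≤pred[n]; any?)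
open import Data.Bool using (Bool; true; false; _∧_; _∨_; not) renaming (_≟_ to _≟ᵇ_)
open import Data.Bool.Properties using (T-≡; ¬-not)
open import Data.Bool.ListAction using (any)
open import Data.Maybe using (Maybe; just; nothing; _>>=_)
open import Data.Maybe.Properties using (just-injective)
open import Data.List using (List; []; _∷_; length; filterᵇ; upTo; allFin)
open import Data.List.Relation.Unary.Any using (here; there)
open import Data.List.Relation.Unary.Any.Properties using (any⁺; any⁻)
open import Data.List.Relation.Unary.All as All using (All; []; _∷_)
open import Data.List.Relation.Unary.All.Properties using (¬Any⇒All¬)
open import Data.List.Relation.Unary.AllPairs.Core using ([]; _∷_)
open import Data.List.Relation.Unary.Unique.Propositional using (Unique)
open import Data.List.Relation.Unary.Unique.Propositional.Properties using (allFin⁺)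
open import Data.List.Membership.Propositional using (_∈_; find; lose)
open import Data.List.Membership.Propositional.Properties using (∈-allFin; ∈-upTo⁺)
open import Data.Vec using (fromList; last)
open import Data.Vec.Properties using (toList∘fromList)
open import Data.Product using (Σ; ∃; _×_; _,_; proj₁; proj₂)
open import Data.Sum using (_⊎_; inj₁; inj₂)
open import Data.Unit using (tt)
open import Data.Empty using (⊥; ⊥-elim)
open import Function using (_∘_)
open import Function.Bundles using (Equivalence)
open import Relation.Binary.PropositionalEquality using (_≡_; refl; sym; trans; cong; cong₂; subst; module ≡-Reasoning)
open import Relation.Nullary using (¬_; yes; no)
open import Relation.Nullary.Decidable using (⌊_⌋)

true≢false : ¬ (true ≡ false)
true≢false ()

∧-true⁻ : ∀ {a b} → a ∧ b ≡ true → a ≡ true × b ≡ true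
∧-true⁻ {true} {true} _ = refl , refl

∧-true⁺ : ∀ {a b} → a ≡ true → b ≡ true → a ∧ b ≡ true
∧-true⁺ refl refl = refl

not-true⁻ : ∀ {b} → not b ≡ true → b ≡ false
not-true⁻ {false} _ = refl

module _ {n : ℕ} where

  ≟-refl : (a : Fin n) → ⌊ a ≟ a ⌋ ≡ true
  ≟-refl a with a ≟ a
  ... | yes _ = refl
  ... | no a≢a = ⊥-elim (a≢a refl)

  ≟-true⁻ : ∀ {a b : Fin n} → ⌊ a ≟ b ⌋ ≡ true → a ≡ b
  ≟-true⁻ {a} {b} h with a ≟ b
  ... | yes a≡b = a≡b

  ≟-false⁺ : ∀ {a b : Fin n} → ¬ a ≡ b → ⌊ a ≟ b ⌋ ≡ false
  ≟-false⁺ {a} {b} a≢b with a ≟ b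
  ... | yes a≡b = ⊥-elim (a≢b a≡b)
  ... | no _ = refl

  not-≟⁺ : ∀ {a b : Fin n} → ¬ a ≡ b → not ⌊ a ≟ b ⌋ ≡ true
  not-≟⁺ a≢b rewrite ≟-false⁺ a≢b = refl

  not-≟⁻ : ∀ {a b : Fin n} → not ⌊ a ≟ b ⌋ ≡ true → ¬ a ≡ b
  not-≟⁻ {a} h refl rewrite ≟-refl a = true≢false (sym h)

-- Counting

module _ {A : Set} where

  any-true⁺ : (f : A → Bool) {xs : List A} {x : A} → x ∈ xs → f x ≡ true → any f xs ≡ true
  any-true⁺ f x∈xs fx = Equivalence.to T-≡ (any⁺ f (lose x∈xs (Equivalence.from T-≡ fx)))

  any-true⁻ : (f : A → Bool) (xs : List A) → any f xs ≡ true → ∃ λ x → x ∈ xs × f x ≡ true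
  any-true⁻ f xs h with x , x∈xs , fx ← find (any⁻ f xs (Equivalence.from T-≡ h)) =
    x , x∈xs , Equivalence.to T-≡ fx

  any-cong : {f g : A → Bool} → (∀ x → f x ≡ g x) → (xs : List A) → any f xs ≡ any g xs
  any-cong f≗g []       = refl
  any-cong f≗g (x ∷ xs) = cong₂ _∨_ (f≗g x) (any-cong f≗g xs)

  card : (A → Bool) → List A → ℕ
  card f xs = length (filterᵇ f xs)

  card-cong : {f g : A → Bool} → (∀ x → f x ≡ g x) → (xs : List A) → card f xs ≡ card g xs
  card-cong f≗g [] = refl
  card-cong {f} {g} f≗g (x ∷ xs) with f x | g x | f≗g x
  ... | true  | .true  | refl = cong suc (card-cong f≗g xs)
  ... | false | .false | refl = card-cong f≗g xs

  card-mono : {f g : A → Bool} → (∀ x → f x ≡ true → g x ≡ true) → (xs : List A) → card f xs ≤ card g xs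
  card-mono f⊆g [] = z≤n
  card-mono {f} {g} f⊆g (x ∷ xs) with f x in fx | g x in gx
  ... | true  | true  = s≤s (card-mono f⊆g xs)
  ... | true  | false = ⊥-elim (true≢false (trans (sym (f⊆g x fx)) gx))
  ... | false | true  = m≤n⇒m≤1+n (card-mono f⊆g xs)
  ... | false | false = card-mono f⊆g xs

  card-split : (f c : A → Bool) (xs : List A) →
               card f xs ≡ card (λ v → f v ∧ not (c v)) xs + card (λ v → f v ∧ c v) xs
  card-split f c [] = refl
  card-split f c (x ∷ xs) with f x | c x
  ... | true  | true  = trans (cong suc (card-split f c xs)) (sym (+-suc _ _))
  ... | true  | false = cong suc (card-split f c xs)
  ... | false | _     = card-split f c xs

  card-zero : (f : A → Bool) (xs : List A) → All (λ x → f x ≡ false) xs → card f xs ≡ 0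
  card-zero f [] [] = refl
  card-zero f (x ∷ xs) (fx ∷ fxs) rewrite fx = card-zero f xs fxs

  card-pos : (f : A → Bool) {xs : List A} {x : A} → x ∈ xs → f x ≡ true → 1 ≤ card f xs
  card-pos f {y ∷ xs} x∈xs fx with f y in fy
  ... | true = s≤s z≤n
  card-pos f {y ∷ xs} (here refl) fx | false = ⊥-elim (true≢false (trans (sym fx) fy))
  card-pos f {y ∷ xs} (there x∈xs) fx | false = card-pos f x∈xs fx

module _ {n : ℕ} where

  infixl 6 _─_

  _─_ : (Fin n → Bool) → Fin n → (Fin n → Bool)
  (f ─ a) v = f v ∧ not ⌊ v ≟ a ⌋

  #_ : (Fin n → Bool) → ℕ
  # f = card f (allFin n)

  #-singleton≤1 : (a : Fin n) → # (λ v → ⌊ v ≟ a ⌋) ≤ 1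
  #-singleton≤1 a = go (allFin n) (allFin⁺ n)
    where
    go : (xs : List (Fin n)) → Unique xs → card (λ v → ⌊ v ≟ a ⌋) xs ≤ 1
    go [] _ = z≤n
    go (x ∷ xs) (x∉xs ∷ u) with x ≟ a
    ... | yes refl = s≤s (≤-reflexive (card-zero _ xs (All.map (λ x≢y → ≟-false⁺ (λ y≡x → x≢y (sym y≡x))) x∉xs)))
    ... | no _ = go xs u

  #≤suc#─ : (f : Fin n → Bool) (a : Fin n) → # f ≤ suc (# (f ─ a))
  #≤suc#─ f a rewrite card-split f (λ v → ⌊ v ≟ a ⌋) (allFin n) | +-comm (# (f ─ a)) (# (λ v → f v ∧ ⌊ v ≟ a ⌋)) =
    +-monoˡ-≤ (# (f ─ a))
      (≤-trans (card-mono (λ v h → proj₂ (∧-true⁻ {f v} h)) (allFin n)) (#-singleton≤1 a))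

  suc#─≤# : (f : Fin n → Bool) (a : Fin n) → f a ≡ true → suc (# (f ─ a)) ≤ # f
  suc#─≤# f a fa rewrite card-split f (λ v → ⌊ v ≟ a ⌋) (allFin n) | +-comm (# (f ─ a)) (# (λ v → f v ∧ ⌊ v ≟ a ⌋)) =
    +-monoˡ-≤ (# (f ─ a)) (card-pos _ (∈-allFin a) (∧-true⁺ fa (≟-refl a)))

-- Walks and paths

module Walks {n : ℕ} (Adj : Fin n → Fin n → Bool) where

  _⊆ᵇ_ : (Fin n → Bool) → (Fin n → Bool) → Set
  W ⊆ᵇ W' = ∀ v → W v ≡ true → W' v ≡ true

  walk-mono : ∀ {W W'} → W ⊆ᵇ W' → ∀ {a b} → WalkIn Adj W a b → WalkIn Adj W' a b
  walk-mono W⊆W' (here wa)        = here (W⊆W' _ wa)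
  walk-mono W⊆W' (step wa adj ws) = step (W⊆W' _ wa) adj (walk-mono W⊆W' ws)

  walk-source : ∀ {W a b} → WalkIn Adj W a b → W a ≡ true
  walk-source (here wa)     = wa
  walk-source (step wa _ _) = wa

  _++ʷ_ : ∀ {W a b c} → WalkIn Adj W a b → WalkIn Adj W b c → WalkIn Adj W a c
  here _          ++ʷ ws′ = ws′
  step wa adj ws  ++ʷ ws′ = step wa adj (ws ++ʷ ws′)

  connectedIn-cong : ∀ {W W'} → (∀ v → W v ≡ W' v) → ConnectedIn Adj W → ConnectedIn Adj W'
  connectedIn-cong W≗W' conn a b wa wb =
    walk-mono (λ v e → trans (sym (W≗W' v)) e) (conn a b (trans (W≗W' a) wa) (trans (W≗W' b) wb))

  walk-leaves : ∀ {W Y : Fin n → Bool} {a b} → WalkIn Adj W a b → Y a ≡ true → Y b ≡ false →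
                Σ (Fin n) λ x → Σ (Fin n) λ x' →
                  Y x ≡ true × W x ≡ true × Adj x x' ≡ true × W x' ≡ true × Y x' ≡ false
  walk-leaves (here _) ya yb = ⊥-elim (true≢false (trans (sym ya) yb))
  walk-leaves {Y = Y} {a = a} (step {c = c} wa adj ws) ya yb with Y c in yc
  ... | true  = walk-leaves ws yc yb
  ... | false = a , c , ya , wa , adj , walk-source ws , yc

  walk-confine : ∀ {W Z : Fin n → Bool} {a b} →
                 (∀ s t → Z s ≡ true → W t ≡ true → Z t ≡ false → Adj s t ≡ true → s ≡ b) →
                 Z a ≡ true → WalkIn Adj W a b → WalkIn Adj Z a b
  walk-confine exits za (here _) = here za
  walk-confine {Z = Z} {a = a} exits za (step {c = c} _ adj ws) with Z c in zc
  ... | true = step za adj (walk-confine exits zc ws)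
  ... | false with exits a c za (walk-source ws) zc adj
  ... | refl = here za

  module _ (Adj-sym : ∀ a b → Adj a b ≡ Adj b a) where

    walk-reverse : ∀ {W a b} → WalkIn Adj W a b → WalkIn Adj W b a
    walk-reverse (here wa) = here wa
    walk-reverse {a = a} (step {c = c} wa adj ws) =
      walk-reverse ws ++ʷ step (walk-source ws) (trans (Adj-sym c a) adj) (here wa)

    connectedIn-hub : ∀ {W} b → (∀ u → W u ≡ true → WalkIn Adj W u b) → ConnectedIn Adj W
    connectedIn-hub b to-b a c wa wc = to-b a wa ++ʷ walk-reverse (to-b c wc)

module Paths {n : ℕ} (Adj : Fin n → Fin n → Bool) where

  open import Data.List.Membership.DecPropositional (_≟_ {n}) using (_∈?_)

  endpoint : Fin n → List (Fin n) → Fin n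
  endpoint a []       = a
  endpoint a (y ∷ ys) = endpoint y ys

  PathIn : (Fin n → Bool) → Fin n → Fin n → Set
  PathIn W a b = Σ (List (Fin n)) λ ys →
    Unique (a ∷ ys) × PathAdj Adj (a ∷ ys) × All (λ x → W x ≡ true) (a ∷ ys) × endpoint a ys ≡ b

  path-suffix : ∀ {W a x xs} → a ∈ x ∷ xs → Unique (x ∷ xs) → PathAdj Adj (x ∷ xs) →
                All (λ v → W v ≡ true) (x ∷ xs) → PathIn W a (endpoint x xs)
  path-suffix {xs = xs}     (here refl) u adj w = xs , u , adj , w , refl
  path-suffix {xs = _ ∷ _} (there a∈)  (_ ∷ u) (_ , adj) (_ ∷ w) = path-suffix a∈ u adj w

  -- loop erasure
  walk→path : ∀ {W a b} → WalkIn Adj W a b → PathIn W a b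
  walk→path (here wa) = [] , ([] ∷ []) , tt , (wa ∷ []) , refl
  walk→path {a = a} (step {c = c} wa adj ws) with walk→path ws
  ... | ys , u , adjs , w , end with a ∈? (c ∷ ys)
  ... | yes a∈ with ys′ , u′ , adjs′ , w′ , end′ ← path-suffix a∈ u adjs w = ys′ , u′ , adjs′ , w′ , trans end′ end
  ... | no a∉ = c ∷ ys , (¬Any⇒All¬ (c ∷ ys) a∉ ∷ u) , (adj , adjs) , (wa ∷ w) , end

  last-fromList : (x : Fin n) (xs : List (Fin n)) → last (fromList (x ∷ xs)) ≡ endpoint x xs
  last-fromList x []       = refl
  last-fromList x (y ∷ ys) = last-fromList y ys

  -- two distinct neighbours of v joined by a path avoiding v close a cycle
  unique-neighbour : IsTree Adj → ∀ {W v a b} → ConnectedIn Adj W → W v ≡ false →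
                     W a ≡ true → W b ≡ true → Adj a v ≡ true → Adj b v ≡ true → a ≡ b
  unique-neighbour (Adj-sym , _ , _ , acyclic) {W} {v} {a} {b} conn wv wa wb av bv with a ≟ b
  ... | yes a≡b = a≡b
  ... | no a≢b with walk→path (conn a b wa wb)
  ... | [] , _ , _ , _ , a≡b = ⊥-elim (a≢b a≡b)
  ... | c ∷ ys , u , adjs , w , end =
    ⊥-elim (acyclic (length ys , fromList cyc ,
      subst Unique (sym (toList∘fromList cyc)) (All.map v∉ w ∷ u) ,
      subst (PathAdj Adj) (sym (toList∘fromList cyc)) (trans (Adj-sym v a) av , adjs) ,
      subst (λ z → Adj z v ≡ true) (sym (trans (last-fromList v (a ∷ c ∷ ys)) end)) bv))
    where
    cyc : List (Fin n)
    cyc = v ∷ a ∷ c ∷ ys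
    v∉ : ∀ {x} → W x ≡ true → ¬ v ≡ x
    v∉ wx refl = true≢false (trans (sym wx) wv)

-- Rooted trees

module RootedTree {n : ℕ} (par : Parent n) where

  -- Desc x y means y ∈ V(T_x)
  data Desc (x : Fin n) : Fin n → Set where
    self : Desc x x
    up   : ∀ {y z} → par y ≡ just z → Desc x z → Desc x y

  Desc-trans : ∀ {a b c} → Desc a b → Desc b c → Desc a c
  Desc-trans dab self        = dab
  Desc-trans dab (up pc dbz) = up pc (Desc-trans dab dbz)

  parent-Desc : ∀ {y z} → par y ≡ just z → Desc z y
  parent-Desc py = up py self

  Desc-comparable : ∀ {a b v} → Desc a v → Desc b v → Desc a b ⊎ Desc b a
  Desc-comparable self           dbv            = inj₂ dbv
  Desc-comparable (up pv daz)    self           = inj₁ (up pv daz)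
  Desc-comparable (up pv daz)    (up pv′ dbz′) with trans (sym pv) pv′
  ... | refl = Desc-comparable daz dbz′

  Desc-via-parent : ∀ {x v w} → par v ≡ just w → Desc x v → ¬ x ≡ v → Desc x w
  Desc-via-parent pv self        x≢v = ⊥-elim (x≢v refl)
  Desc-via-parent pv (up pv′ dxw) _  with trans (sym pv) pv′
  ... | refl = dxw

  Desc-child : ∀ {q x} → Desc q x → ¬ x ≡ q → Σ (Fin n) λ c → par c ≡ just q × Desc c x
  Desc-child self x≢q = ⊥-elim (x≢q refl)
  Desc-child {q} (up {y} {z} py dqz) _ with z ≟ q
  ... | yes refl = y , py , self
  ... | no z≢q with c , pc , dcz ← Desc-child dqz z≢q = c , pc , up py dcz

  iter-step : ∀ {y z} → par y ≡ just z → ∀ i → iter par (suc i) y ≡ iter par i z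
  iter-step py zero = py
  iter-step py (suc i) rewrite iter-step py i = refl

  iter-+ : ∀ i j y → iter par (i + j) y ≡ (iter par j y >>= iter par i)
  iter-+ zero j y with iter par j y
  ... | just _  = refl
  ... | nothing = refl
  iter-+ (suc i) j y rewrite iter-+ i j y with iter par j y
  ... | just _  = refl
  ... | nothing = refl

  iter→Desc : ∀ {x} i y → iter par i y ≡ just x → Desc x y
  iter→Desc zero y refl = self
  iter→Desc (suc i) y h with iter par i y in e
  ... | just u = Desc-trans (parent-Desc h) (iter→Desc i y e)

  Desc→iter : ∀ {x y} → Desc x y → Σ ℕ λ i → iter par i y ≡ just x
  Desc→iter self = 0 , refl
  Desc→iter (up py dxz) with i , h ← Desc→iter dxz = suc i , trans (iter-step py i) h

  eqᴹ-true⁻ : ∀ {m : Maybe (Fin n)} {x} → eqᴹ m x ≡ true → m ≡ just x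
  eqᴹ-true⁻ {just a} e = cong just (≟-true⁻ e)

  inT→Desc : ∀ {x y} → inT par x y ≡ true → Desc x y
  inT→Desc {x} {y} h with i , _ , e ← any-true⁻ _ (upTo (suc n)) h = iter→Desc i y (eqᴹ-true⁻ e)

  module Rooted (rooted : IsRootedTree par) where

    root : Fin n
    root = proj₁ rooted

    par-root : par root ≡ nothing
    par-root = proj₁ (proj₂ rooted)

    root-unique : ∀ x → par x ≡ nothing → x ≡ root
    root-unique = proj₁ (proj₂ (proj₂ rooted))

    Desc-root : ∀ x → Desc root x
    Desc-root x with i , h ← proj₂ (proj₂ (proj₂ rooted)) x = iter→Desc i x h

    -- a node below its own parent would pass this property on to its parent, and so on up to the root
    parent-not-Desc : ∀ {v w} → par v ≡ just w → ¬ Desc v w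
    parent-not-Desc {v} = go (Desc-root v)
      where
      go : ∀ {v w} → Desc root v → par v ≡ just w → ¬ Desc v w
      go self pv _ with trans (sym par-root) pv
      ... | ()
      go (up pv′ drz) pv dvw with trans (sym pv′) pv
      go (up pv′ drz) pv self           | refl = go drz pv self
      go (up pv′ drz) pv (up pz dvz′)   | refl = go drz pz (Desc-trans (parent-Desc pv) dvz′)

    iter-acyclic : ∀ d w → ¬ iter par (suc d) w ≡ just w
    iter-acyclic d w h with iter par d w in e
    ... | just u = parent-not-Desc h (iter→Desc d w e)

    iter-defined : ∀ {j i y x} → j ≤ i → iter par i y ≡ just x → Σ (Fin n) λ w → iter par j y ≡ just w
    iter-defined {j} {i} {y} j≤i h with iter par j y in e | m≤n⇒∃[o]m+o≡n j≤i
    ... | just w  | _ = w , refl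
    ... | nothing | o , refl rewrite +-comm j o | iter-+ o j y | e with h
    ... | ()

    -- a chain of n + 1 ancestors must repeat a node
    iter-bound : ∀ {i y x} → iter par i y ≡ just x → i < suc n
    iter-bound {i} {y} h with suc i ≤? suc n
    ... | yes i<1+n = i<1+n
    ... | no i≮1+n = ⊥-elim (no-repeat (pigeonhole (n<1+n n) node))
      where
      j≤i : (j : Fin (suc n)) → toℕ j ≤ i
      j≤i j with s≤s n<i ← ≰⇒> i≮1+n = ≤-trans (toℕ≤pred[n] j) (<⇒≤ n<i)
      node : Fin (suc n) → Fin n
      node j = proj₁ (iter-defined (j≤i j) h)
      node-iter : ∀ j → iter par (toℕ j) y ≡ just (node j)
      node-iter j = proj₂ (iter-defined (j≤i j) h)
      no-repeat : Σ (Fin (suc n)) (λ a → Σ (Fin (suc n)) λ b → toℕ a < toℕ b × node a ≡ node b) → ⊥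
      no-repeat (a , b , a<b , same) with o , a+o≡b ← m≤n⇒∃[o]m+o≡n a<b =
        iter-acyclic o (node a) (begin
          iter par (suc o) (node a)                       ≡⟨ sym (cong (_>>= iter par (suc o)) (node-iter a)) ⟩
          (iter par (toℕ a) y >>= iter par (suc o))        ≡⟨ sym (iter-+ (suc o) (toℕ a) y) ⟩
          iter par (suc o + toℕ a) y                      ≡⟨ cong (λ m → iter par m y) (trans (cong suc (+-comm o (toℕ a))) a+o≡b) ⟩
          iter par (toℕ b) y                              ≡⟨ node-iter b ⟩
          just (node b)                                   ≡⟨ cong just (sym same) ⟩
          just (node a)                                   ∎)
        where open ≡-Reasoning

    Desc→inT : ∀ {x y} → Desc x y → inT par x y ≡ true
    Desc→inT {x} {y} dxy with i , h ← Desc→iter dxy =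
      any-true⁺ (λ i → eqᴹ (iter par i y) x) {x = i} (∈-upTo⁺ (iter-bound h)) (eqᴹ-just h)
      where
      eqᴹ-just : ∀ {m} → m ≡ just x → eqᴹ m x ≡ true
      eqᴹ-just refl = ≟-refl x

    ¬Desc→inT : ∀ {x y} → ¬ Desc x y → inT par x y ≡ false
    ¬Desc→inT {x} {y} ¬dxy with inT par x y in e
    ... | true  = ⊥-elim (¬dxy (inT→Desc e))
    ... | false = refl

    inT-false→¬Desc : ∀ {x y} → inT par x y ≡ false → ¬ Desc x y
    inT-false→¬Desc e dxy = true≢false (trans (sym (Desc→inT dxy)) e)

    Desc? : ∀ x v → Desc x v ⊎ ¬ Desc x v
    Desc? x v with inT par x v in e
    ... | true  = inj₁ (inT→Desc e)
    ... | false = inj₂ (inT-false→¬Desc e)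

module Boundary {n : ℕ} (S : Fin n → Fin n → Bool) (par : Parent n) (rooted : IsRootedTree par) where
  open RootedTree par
  open Rooted rooted

  δ⁺ : ∀ {x u v} → ¬ Desc x v → Desc x u → S u v ≡ true → δ S par x v ≡ true
  δ⁺ {x} {u} {v} ¬dxv dxu suv rewrite ¬Desc→inT ¬dxv =
    any-true⁺ _ (∈-allFin u) (∧-true⁺ (Desc→inT dxu) suv)

  ∣δ∣-root : ∀ {x} → par x ≡ nothing → ∣δ∣ S par x ≡ 0
  ∣δ∣-root px with refl ← root-unique _ px = card-zero _ (allFin n) (All.universal outside (allFin n))
    where
    outside : ∀ v → δ S par root v ≡ false
    outside v rewrite Desc→inT (Desc-root v) = refl

  parent-of-boundary : ∀ {x m} → ∣δ∣ S par x ≡ suc m → Σ (Fin n) λ w → par x ≡ just w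
  parent-of-boundary {x} h with par x in px
  ... | just w  = w , refl
  ... | nothing with () ← trans (sym h) (∣δ∣-root px)

  δ⁻ : ∀ {x v} → δ S par x v ≡ true → ¬ Desc x v × Σ (Fin n) λ u → Desc x u × S u v ≡ true
  δ⁻ {x} {v} h with inT par x v in e
  ... | false with u , _ , h′ ← any-true⁻ _ (allFin n) h with ∧-true⁻ {inT par x u} h′
  ... | xu , suv = inT-false→¬Desc e , u , inT→Desc xu , suv

-- Rotation at q, whose parent p has parent g

module Rotation {n : ℕ} (S : Fin n → Fin n → Bool) (tree : IsTree S)
  (T : Parent n) (stt : IsSTT S T) {q p g : Fin n} (Tq : T q ≡ just p) (Tp : T p ≡ just g) where

  open RootedTree T
  open Rooted (proj₁ stt)
  open Walks S
  open Paths S using (unique-neighbour)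

  T′ : Parent n
  T′ = rotate S T q p

  module D′ = RootedTree T′

  S-sym : ∀ a b → S a b ≡ S b a
  S-sym = proj₁ tree

  connected : ∀ {x c} → T c ≡ just x → ConnectedIn S (inT T c)
  connected {x} {c} Tc = proj₁ (proj₂ stt x c Tc)

  separated : ∀ {x c} → T c ≡ just x → ∀ {u v} → Desc c u → Desc x v → ¬ v ≡ x → ¬ Desc c v → S u v ≡ false
  separated {x} {c} Tc {u} {v} dcu dxv v≢x ¬dcv =
    proj₂ (proj₂ stt x c Tc) u v (Desc→inT dcu) (Desc→inT dxv) v≢x (¬Desc→inT ¬dcv)

  p≢q : ¬ p ≡ q
  p≢q refl = parent-not-Desc Tq self

  moves : Fin n → Bool
  moves c = eqᴹ (T c) q ∧ any (λ z → inT T c z ∧ S z p) (allFin n)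

  moves⁻ : ∀ {c} → moves c ≡ true → T c ≡ just q × Σ (Fin n) λ z → Desc c z × S z p ≡ true
  moves⁻ {c} h with ∧-true⁻ {eqᴹ (T c) q} h
  ... | Tc , adj with z , _ , h′ ← any-true⁻ _ (allFin n) adj with ∧-true⁻ {inT T c z} h′
  ... | cz , szp = eqᴹ-true⁻ Tc , z , inT→Desc cz , szp

  moves⁺ : ∀ {c z} → T c ≡ just q → Desc c z → S z p ≡ true → moves c ≡ true
  moves⁺ {c} {z} Tc dcz szp rewrite Tc =
    ∧-true⁺ (≟-refl q) (any-true⁺ _ (∈-allFin z) (∧-true⁺ (Desc→inT dcz) szp))

  moving-parent : ∀ {c} → moves c ≡ true → T c ≡ just q
  moving-parent mc = proj₁ (moves⁻ mc)

  moving-Desc-q : ∀ {c v} → moves c ≡ true → Desc c v → Desc q v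
  moving-Desc-q mc = Desc-trans (parent-Desc (moving-parent mc))

  T′-q : T′ q ≡ T p
  T′-q rewrite ≟-refl q = refl

  T′-p : T′ p ≡ just q
  T′-p rewrite ≟-false⁺ p≢q | ≟-refl p = refl

  T′-moving : ∀ {v} → ¬ v ≡ q → ¬ v ≡ p → moves v ≡ true → T′ v ≡ just p
  T′-moving v≢q v≢p mv rewrite ≟-false⁺ v≢q | ≟-false⁺ v≢p | mv = refl

  T′-fixed : ∀ {v} → ¬ v ≡ q → ¬ v ≡ p → moves v ≡ false → T′ v ≡ T v
  T′-fixed v≢q v≢p mv rewrite ≟-false⁺ v≢q | ≟-false⁺ v≢p | mv = refl

  data Case (v : Fin n) : Set where
    at-q   : v ≡ q → Case v
    at-p   : v ≡ p → Case v
    moving : moves v ≡ true → T′ v ≡ just p → Case v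
    fixed  : ¬ v ≡ q → ¬ v ≡ p → moves v ≡ false → T′ v ≡ T v → Case v

  case : ∀ v → Case v
  case v with v ≟ q | v ≟ p | moves v in mv
  ... | yes v≡q | _       | _     = at-q v≡q
  ... | no _    | yes v≡p | _     = at-p v≡p
  ... | no v≢q  | no v≢p  | true  = moving mv (T′-moving v≢q v≢p mv)
  ... | no v≢q  | no v≢p  | false = fixed v≢q v≢p mv (T′-fixed v≢q v≢p mv)

  moving-¬Desc-q : ∀ {c} → moves c ≡ true → ¬ Desc c q
  moving-¬Desc-q mc = parent-not-Desc (moving-parent mc)

  moving-≢q : ∀ {c} → moves c ≡ true → ¬ c ≡ q
  moving-≢q mc refl = moving-¬Desc-q mc self

  moving-≢p : ∀ {c} → moves c ≡ true → ¬ c ≡ p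
  moving-≢p mc refl = moving-¬Desc-q mc (parent-Desc Tq)

  T′-moves : ∀ {c} → moves c ≡ true → T′ c ≡ just p
  T′-moves mc = T′-moving (moving-≢q mc) (moving-≢p mc) mc

  data InT′p (v : Fin n) : Set where
    kept  : Desc p v → ¬ Desc q v → InT′p v
    moved : ∀ {c} → moves c ≡ true → Desc c v → InT′p v

  InT′p⇒Desc-p : ∀ {v} → InT′p v → Desc p v
  InT′p⇒Desc-p (kept dpv _)   = dpv
  InT′p⇒Desc-p (moved mc dcv) = Desc-trans (parent-Desc Tq) (moving-Desc-q mc dcv)

  data RotatedDesc (x v : Fin n) : Set where
    unchanged : ¬ x ≡ p → ¬ x ≡ q → Desc x v → RotatedDesc x v
    below-q   : x ≡ q → Desc p v → RotatedDesc x v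
    below-p   : x ≡ p → InT′p v → RotatedDesc x v

  private
    into-q : ∀ {x w} → T p ≡ just w → RotatedDesc x w → RotatedDesc x q
    into-q Tpw (unchanged x≢p x≢q dxw)  = unchanged x≢p x≢q (up Tq (up Tpw dxw))
    into-q Tpw (below-q _ dpw)          = ⊥-elim (parent-not-Desc Tpw dpw)
    into-q Tpw (below-p _ (kept dpw _)) = ⊥-elim (parent-not-Desc Tpw dpw)
    into-q Tpw (below-p _ (moved mc dcw)) =
      ⊥-elim (moving-¬Desc-q mc (Desc-trans dcw (up Tq (parent-Desc Tpw))))

    into-p : ∀ {x} → RotatedDesc x q → RotatedDesc x p
    into-p (unchanged x≢p x≢q dxq)    = unchanged x≢p x≢q (Desc-via-parent Tq dxq x≢q)
    into-p (below-q x≡q _)            = below-q x≡q self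
    into-p (below-p _ (kept _ ¬dqq))  = ⊥-elim (¬dqq self)
    into-p (below-p _ (moved mc dcq)) = ⊥-elim (moving-¬Desc-q mc dcq)

    into-moving : ∀ {x v} → moves v ≡ true → RotatedDesc x p → RotatedDesc x v
    into-moving mv (unchanged x≢p x≢q dxp) = unchanged x≢p x≢q (up (moving-parent mv) (up Tq dxp))
    into-moving mv (below-q x≡q _)         = below-q x≡q (up (moving-parent mv) (parent-Desc Tq))
    into-moving mv (below-p x≡p _)         = below-p x≡p (moved mv self)

    into-fixed : ∀ {x v w} → ¬ v ≡ q → T v ≡ just w → RotatedDesc x w → RotatedDesc x v
    into-fixed v≢q Tv (unchanged x≢p x≢q dxw)    = unchanged x≢p x≢q (up Tv dxw)
    into-fixed v≢q Tv (below-q x≡q dpw)          = below-q x≡q (up Tv dpw)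
    into-fixed v≢q Tv (below-p x≡p (kept dpw ¬dqw)) =
      below-p x≡p (kept (up Tv dpw) (λ dqv → ¬dqw (Desc-via-parent Tv dqv (λ q≡v → v≢q (sym q≡v)))))
    into-fixed v≢q Tv (below-p x≡p (moved mc dcw)) = below-p x≡p (moved mc (up Tv dcw))

    forward-step : ∀ {x v w} → Case v → T′ v ≡ just w → RotatedDesc x w → RotatedDesc x v
    forward-step (at-q refl) T′q r = into-q (trans (sym T′-q) T′q) r
    forward-step (at-p refl) T′p r with refl ← just-injective (trans (sym T′-p) T′p) = into-p r
    forward-step (moving mv T′v) T′v′ r with refl ← just-injective (trans (sym T′v) T′v′) = into-moving mv r
    forward-step (fixed v≢q _ _ T′v) T′v′ r = into-fixed v≢q (trans (sym T′v) T′v′) r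

  forward : ∀ {x v} → D′.Desc x v → RotatedDesc x v
  forward {x} D′.self with x ≟ q | x ≟ p
  ... | yes refl | _        = below-q refl (parent-Desc Tq)
  ... | no _     | yes refl = below-p refl (kept self (parent-not-Desc Tq))
  ... | no x≢q   | no x≢p   = unchanged x≢p x≢q self
  forward {v = v} (D′.up T′v dxw) = forward-step (case v) T′v (forward dxw)

  backward-unchanged : ∀ {x v} → ¬ x ≡ p → ¬ x ≡ q → Desc x v → D′.Desc x v
  backward-unchanged x≢p x≢q self = D′.self
  backward-unchanged {v = v} x≢p x≢q (up Tv dxw) with case v | backward-unchanged x≢p x≢q dxw
  ... | at-q refl | dxw′ with refl ← just-injective (trans (sym Tq) Tv) = D′.Desc-via-parent T′-p dxw′ x≢p
  ... | at-p refl | dxw′ = D′.up T′-p (D′.up (trans T′-q Tv) dxw′)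
  ... | moving mv T′v | dxw′ with refl ← just-injective (trans (sym Tv) (moving-parent mv)) =
    D′.up T′v (D′.up T′-p dxw′)
  ... | fixed _ _ _ T′v | dxw′ = D′.up (trans T′v Tv) dxw′

  backward-q : ∀ {v} → Desc p v → D′.Desc q v
  backward-q self = D′.up T′-p D′.self
  backward-q {v} (up Tv dpw) with case v
  ... | at-q refl         = D′.self
  ... | at-p refl         = ⊥-elim (parent-not-Desc Tv dpw)
  ... | moving _ T′v      = D′.up T′v (D′.up T′-p D′.self)
  ... | fixed _ _ _ T′v   = D′.up (trans T′v Tv) (backward-q dpw)

  backward-kept : ∀ {v} → Desc p v → ¬ Desc q v → D′.Desc p v
  backward-kept self _ = D′.self
  backward-kept {v} (up Tv dpw) ¬dqv with case v
  ... | at-q refl         = ⊥-elim (¬dqv self)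
  ... | at-p refl         = ⊥-elim (parent-not-Desc Tv dpw)
  ... | moving mv _       = ⊥-elim (¬dqv (parent-Desc (moving-parent mv)))
  ... | fixed _ _ _ T′v   = D′.up (trans T′v Tv) (backward-kept dpw (λ dqw → ¬dqv (up Tv dqw)))

  backward-moved : ∀ {c v} → moves c ≡ true → Desc c v → D′.Desc p v
  backward-moved mc self = D′.up (T′-moves mc) D′.self
  backward-moved {v = v} mc (up Tv dcw) with case v
  ... | at-q refl       = ⊥-elim (moving-¬Desc-q mc (up Tq (subst (Desc _) (just-injective (trans (sym Tv) Tq)) dcw)))
  ... | at-p refl       = ⊥-elim (moving-¬Desc-q mc (up Tq (up Tv dcw)))
  ... | moving mv _     = ⊥-elim (moving-¬Desc-q mc (subst (Desc _) (just-injective (trans (sym Tv) (moving-parent mv))) dcw))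
  ... | fixed _ _ _ T′v = D′.up (trans T′v Tv) (backward-moved mc dcw)

  rooted′ : IsRootedTree T′
  rooted′ = root , T′-root , T′-root-unique , λ x → D′.Desc→iter (backward-unchanged root≢p root≢q (Desc-root x))
    where
    has-parent-≢root : ∀ {v w} → T v ≡ just w → ¬ root ≡ v
    has-parent-≢root Tv refl with trans (sym par-root) Tv
    ... | ()
    root≢p : ¬ root ≡ p
    root≢p = has-parent-≢root Tp
    root≢q : ¬ root ≡ q
    root≢q = has-parent-≢root Tq
    T′-root : T′ root ≡ nothing
    T′-root with case root
    ... | at-q r≡q         = ⊥-elim (root≢q r≡q)
    ... | at-p r≡p         = ⊥-elim (root≢p r≡p)
    ... | moving mv _      = ⊥-elim (has-parent-≢root (moving-parent mv) refl)
    ... | fixed _ _ _ T′r  = trans T′r par-root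
    T′-root-unique : ∀ x → T′ x ≡ nothing → x ≡ root
    T′-root-unique x T′x with case x
    ... | at-q refl with () ← trans (sym Tp) (trans (sym T′-q) T′x)
    T′-root-unique x T′x | at-p refl with () ← trans (sym T′-p) T′x
    T′-root-unique x T′x | moving _ T′v with () ← trans (sym T′v) T′x
    T′-root-unique x T′x | fixed _ _ _ T′v = root-unique x (trans (sym T′v) T′x)

  module R′ = D′.Rooted rooted′

  Desc′-unchanged : ∀ {x v} → ¬ x ≡ p → ¬ x ≡ q → D′.Desc x v → Desc x v
  Desc′-unchanged x≢p x≢q d with forward d
  ... | unchanged _ _ dxv = dxv
  ... | below-q x≡q _     = ⊥-elim (x≢q x≡q)
  ... | below-p x≡p _     = ⊥-elim (x≢p x≡p)

  Desc′-q : ∀ {v} → D′.Desc q v → Desc p v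
  Desc′-q d with forward d
  ... | unchanged _ q≢q _ = ⊥-elim (q≢q refl)
  ... | below-q _ dpv     = dpv
  ... | below-p q≡p _     = ⊥-elim (p≢q (sym q≡p))

  Desc′-p : ∀ {v} → D′.Desc p v → InT′p v
  Desc′-p d with forward d
  ... | unchanged p≢p _ _ = ⊥-elim (p≢p refl)
  ... | below-q p≡q _     = ⊥-elim (p≢q p≡q)
  ... | below-p _ i       = i

  inT-rotate : ∀ {x y v} → (D′.Desc x v → Desc y v) → (Desc y v → D′.Desc x v) → inT T′ x v ≡ inT T y v
  inT-rotate {x} {y} {v} to from with inT T y v in e
  ... | true  = R′.Desc→inT (from (inT→Desc e))
  ... | false = R′.¬Desc→inT (λ d → inT-false→¬Desc e (to d))

  inT′-unchanged : ∀ {x} → ¬ x ≡ p → ¬ x ≡ q → ∀ v → inT T′ x v ≡ inT T x v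
  inT′-unchanged x≢p x≢q v = inT-rotate (Desc′-unchanged x≢p x≢q) (backward-unchanged x≢p x≢q)

  inT′-q : ∀ v → inT T′ q v ≡ inT T p v
  inT′-q v = inT-rotate Desc′-q backward-q

  ∣δ∣-cong : ∀ {x y} → (∀ v → inT T′ x v ≡ inT T y v) → ∣δ∣ S T′ x ≡ ∣δ∣ S T y
  ∣δ∣-cong eq = card-cong (λ v → cong₂ _∧_ (cong not (eq v)) (any-cong (λ u → cong (_∧ S u v) (eq u)) (allFin n))) (allFin n)

  walk-to-p : ∀ {u} → InT′p u → WalkIn S (inT T′ p) u p
  walk-to-p {u} (kept dpu ¬dqu) =
    walk-mono Z⊆T′p (walk-confine exits (Z⁺ dpu ¬dqu)
                       (connected Tp u p (Desc→inT dpu) (Desc→inT self)))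
    where
    Z : Fin n → Bool
    Z v = inT T p v ∧ not (inT T q v)
    Z⁺ : ∀ {v} → Desc p v → ¬ Desc q v → Z v ≡ true
    Z⁺ dpv ¬dqv rewrite Desc→inT dpv | ¬Desc→inT ¬dqv = refl
    Z⁻ : ∀ {v} → Z v ≡ true → Desc p v × ¬ Desc q v
    Z⁻ {v} h with ∧-true⁻ {inT T p v} h
    ... | pv , not-qv = inT→Desc pv , inT-false→¬Desc (not-true⁻ not-qv)
    Z⊆T′p : Z ⊆ᵇ inT T′ p
    Z⊆T′p v h with dpv , ¬dqv ← Z⁻ h = R′.Desc→inT (backward-kept dpv ¬dqv)
    -- T_q hangs off T_p only at p
    exits : ∀ s t → Z s ≡ true → inT T p t ≡ true → Z t ≡ false → S s t ≡ true → s ≡ p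
    exits s t zs pt zt sst with Z⁻ zs | s ≟ p | Desc? q t
    ... | _ | yes s≡p | _ = s≡p
    ... | dps , ¬dqs | no s≢p | inj₁ dqt =
      ⊥-elim (true≢false (trans (sym sst) (trans (S-sym s t) (separated Tq dqt dps s≢p ¬dqs))))
    ... | _ | no _ | inj₂ ¬dqt with () ← trans (sym zt) (Z⁺ (inT→Desc pt) ¬dqt)
  walk-to-p {u} (moved mc dcu) with Tc , z , dcz , szp ← moves⁻ mc =
    walk-mono (λ v h → R′.Desc→inT (backward-moved mc (inT→Desc h))) (connected Tc u z (Desc→inT dcu) (Desc→inT dcz))
    ++ʷ step (R′.Desc→inT (backward-moved mc dcz)) szp (here (R′.Desc→inT D′.self))

  connected-p : ConnectedIn S (inT T′ p)
  connected-p = connectedIn-hub S-sym p (λ u h → walk-to-p (Desc′-p (D′.inT→Desc h)))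

  ChildCondition : Parent n → Fin n → Fin n → Set
  ChildCondition par x c =
    ConnectedIn S (inT par c) ×
    (∀ u v → inT par c u ≡ true → inT par x v ≡ true → ¬ v ≡ x → inT par c v ≡ false → S u v ≡ false)

  child-condition′ : ∀ {x c} → ConnectedIn S (inT T′ c) →
                     (∀ {u v} → D′.Desc c u → D′.Desc x v → ¬ v ≡ x → ¬ D′.Desc c v → S u v ≡ false) →
                     ChildCondition T′ x c
  child-condition′ conn sep =
    conn , λ u v cu xv v≢x ¬cv → sep (D′.inT→Desc cu) (D′.inT→Desc xv) v≢x (R′.inT-false→¬Desc ¬cv)

  -- a neighbour of p below q lies in T′_p
  separated-p : ∀ {u v} → D′.Desc p u → D′.Desc q v → ¬ v ≡ q → ¬ D′.Desc p v → S u v ≡ false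
  separated-p {u} {v} du dv v≢q ¬dv with Desc? q v | Desc′-p du
  ... | inj₂ ¬dqv | _ = ⊥-elim (¬dv (backward-kept (Desc′-q dv) ¬dqv))
  ... | inj₁ dqv | moved mc dcu = separated (moving-parent mc) dcu dqv v≢q (λ dcv → ¬dv (backward-moved mc dcv))
  ... | inj₁ dqv | kept dpu ¬dqu with u ≟ p
  ...   | no u≢p = trans (S-sym u v) (separated Tq dqv dpu u≢p ¬dqu)
  ...   | yes refl with S p v in spv
  ...     | false = refl
  ...     | true with c , Tc , dcv ← Desc-child dqv v≢q =
    ⊥-elim (¬dv (backward-moved (moves⁺ Tc dcv (trans (S-sym v p) spv)) dcv))

  separated-moving : ∀ {c u v} → moves c ≡ true → D′.Desc c u → D′.Desc p v → ¬ v ≡ p → ¬ D′.Desc c v → S u v ≡ false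
  separated-moving {c} mc du dv v≢p ¬dv with Desc′-unchanged (moving-≢p mc) (moving-≢q mc) du | Desc′-p dv
  ... | dcu | kept dpv ¬dqv = separated Tq (moving-Desc-q mc dcu) dpv v≢p ¬dqv
  ... | dcu | moved mc′ dc′v =
    separated (moving-parent mc) dcu (moving-Desc-q mc′ dc′v) (λ { refl → moving-¬Desc-q mc′ dc′v })
              (λ dcv → ¬dv (backward-unchanged (moving-≢p mc) (moving-≢q mc) dcv))

  separated-fixed-q : ∀ {c u v} → T c ≡ just q → moves c ≡ false → ¬ c ≡ p → ¬ c ≡ q →
                      D′.Desc c u → D′.Desc q v → ¬ v ≡ q → ¬ D′.Desc c v → S u v ≡ false
  separated-fixed-q {c} {u} {v} Tc ¬mc c≢p c≢q du dv v≢q ¬dv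
    with Desc′-unchanged c≢p c≢q du | Desc? q v | v ≟ p
  ... | dcu | inj₁ dqv | _ = separated Tc dcu dqv v≢q (λ dcv → ¬dv (backward-unchanged c≢p c≢q dcv))
  ... | dcu | inj₂ ¬dqv | no v≢p = separated Tq (Desc-trans (parent-Desc Tc) dcu) (Desc′-q dv) v≢p ¬dqv
  ... | dcu | inj₂ _ | yes refl with S u p in sup
  ...   | false = refl
  ...   | true with () ← trans (sym (moves⁺ Tc dcu sup)) ¬mc

  g≢p : ¬ g ≡ p
  g≢p refl = parent-not-Desc Tp self

  g≢q : ¬ g ≡ q
  g≢q refl = parent-not-Desc Tp (parent-Desc Tq)

  connected-unchanged : ∀ {x c} → ¬ c ≡ p → ¬ c ≡ q → T c ≡ just x → ConnectedIn S (inT T′ c)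
  connected-unchanged c≢p c≢q Tc = connectedIn-cong (λ v → sym (inT′-unchanged c≢p c≢q v)) (connected Tc)

  separated-unchanged : ∀ {x c u v} → ¬ c ≡ p → ¬ c ≡ q → T c ≡ just x → (D′.Desc x v → Desc x v) →
                        D′.Desc c u → D′.Desc x v → ¬ v ≡ x → ¬ D′.Desc c v → S u v ≡ false
  separated-unchanged c≢p c≢q Tc below-x du dv v≢x ¬dv =
    separated Tc (Desc′-unchanged c≢p c≢q du) (below-x dv) v≢x (¬dv ∘ backward-unchanged c≢p c≢q)

  child-condition-T′ : ∀ x c → T′ c ≡ just x → ChildCondition T′ x c
  child-condition-T′ x c T′c with case c
  ... | at-q refl with refl ← just-injective (trans (sym Tp) (trans (sym T′-q) T′c)) =
    child-condition′ (connectedIn-cong (λ v → sym (inT′-q v)) (connected Tp))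
      (λ du dv v≢g ¬dv → separated Tp (Desc′-q du) (Desc′-unchanged g≢p g≢q dv) v≢g (¬dv ∘ backward-q))
  ... | at-p refl with refl ← just-injective (trans (sym T′-p) T′c) =
    child-condition′ connected-p separated-p
  ... | moving mc T′c′ with refl ← just-injective (trans (sym T′c′) T′c) =
    child-condition′ (connected-unchanged (moving-≢p mc) (moving-≢q mc) (moving-parent mc)) (separated-moving mc)
  ... | fixed c≢q c≢p ¬mc T′c′ with Tc ← trans (sym T′c′) T′c | x ≟ p | x ≟ q
  ...   | yes refl | _ =
    child-condition′ (connected-unchanged c≢p c≢q Tc) (separated-unchanged c≢p c≢q Tc (InT′p⇒Desc-p ∘ Desc′-p))
  ...   | no _ | yes refl =
    child-condition′ (connected-unchanged c≢p c≢q Tc) (separated-fixed-q Tc ¬mc c≢p c≢q)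
  ...   | no x≢p | no x≢q =
    child-condition′ (connected-unchanged c≢p c≢q Tc) (separated-unchanged c≢p c≢q Tc (Desc′-unchanged x≢p x≢q))

  stt′ : IsSTT S T′
  stt′ = rooted′ , child-condition-T′

  open Boundary S T (proj₁ stt)
  module B′ = Boundary S T′ rooted′

  moving-unique : ∀ {c y} → moves c ≡ true → moves y ≡ true → c ≡ y
  moving-unique {c} {y} mc my with moves⁻ mc | moves⁻ my
  ... | Tc , z , dcz , szp | Ty , z′ , dyz′ , sz′p
    with refl ← unique-neighbour tree (connected Tq) (¬Desc→inT (parent-not-Desc Tq))
                  (Desc→inT (moving-Desc-q mc dcz)) (Desc→inT (moving-Desc-q my dyz′)) szp sz′p
    with c ≟ y | Desc-comparable dcz dyz′
  ... | yes c≡y | _ = c≡y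
  ... | no c≢y | inj₁ dcy = ⊥-elim (moving-¬Desc-q mc (Desc-via-parent Ty dcy c≢y))
  ... | no c≢y | inj₂ dyc = ⊥-elim (moving-¬Desc-q my (Desc-via-parent Tc dyc (λ y≡c → c≢y (sym y≡c))))

  p∈δ-moving : ∀ {y} → moves y ≡ true → δ S T y p ≡ true
  p∈δ-moving my with Ty , z , dyz , szp ← moves⁻ my = δ⁺ (moving-¬Desc-q my ∘ up Tq) dyz szp

  -- the walk from y to q inside T_q can leave T_y only towards q
  q∈δ-moving : ∀ {y} → moves y ≡ true → δ S T y q ≡ true
  q∈δ-moving {y} my
    with x , x′ , yx , _ , sxx′ , qx′ , yx′ ←
           walk-leaves {Y = inT T y} (connected Tq y q (Desc→inT (parent-Desc (moving-parent my))) (Desc→inT self))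
                       (Desc→inT self) (¬Desc→inT (moving-¬Desc-q my))
    with inT→Desc qx′ | x′ ≟ q
  ... | _ | yes refl = δ⁺ (moving-¬Desc-q my) (inT→Desc yx) sxx′
  ... | dqx′ | no x′≢q = ⊥-elim (true≢false (trans (sym sxx′)
                    (separated (moving-parent my) (inT→Desc yx) dqx′ x′≢q (inT-false→¬Desc yx′))))

  δ-q─p⊆δ-p : ∀ v → (δ S T q ─ p) v ≡ true → δ S T p v ≡ true
  δ-q─p⊆δ-p v h with ∧-true⁻ {δ S T q v} h
  ... | qv , v≢p with ¬dqv , u , dqu , suv ← δ⁻ qv =
    δ⁺ (λ dpv → true≢false (trans (sym suv) (separated Tq dqu dpv (not-≟⁻ v≢p) ¬dqv))) (Desc-trans (parent-Desc Tq) dqu) suv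

  -- |δ(T_q)| ≤ |δ(T_p)| + 1 always; equality forces the inclusion
  δ-p⊆δ-q : suc (∣δ∣ S T p) ≤ ∣δ∣ S T q → ∀ v → δ S T p v ≡ true → δ S T q v ≡ true
  δ-p⊆δ-q larger v pv with δ S T q v in qv
  ... | true  = refl
  ... | false = ⊥-elim (<-irrefl refl (≤-trans larger (begin
    ∣δ∣ S T q                      ≤⟨ #≤suc#─ (δ S T q) p ⟩
    suc (# (δ S T q ─ p))          ≤⟨ s≤s (card-mono δ-q─p⊆δ-p─v (allFin n)) ⟩
    suc (# (δ S T p ─ v))          ≤⟨ suc#─≤# (δ S T p) v pv ⟩
    ∣δ∣ S T p                      ∎)))
    where
    open ≤-Reasoning
    δ-q─p⊆δ-p─v : ∀ w → (δ S T q ─ p) w ≡ true → (δ S T p ─ v) w ≡ true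
    δ-q─p⊆δ-p─v w h = ∧-true⁺ (δ-q─p⊆δ-p w h) (not-≟⁺ λ { refl → true≢false (trans (sym (proj₁ (∧-true⁻ {δ S T q w} h))) qv) })

  module _ (δ-p⊆δ-q : ∀ v → δ S T p v ≡ true → δ S T q v ≡ true) where

    -- u ∈ V(T′_p) and u′ ∈ V(T_q) are neighbours of v in the connected V(T_p), hence equal
    δ′-p-moving : ∀ {v} → δ S T′ p v ≡ true → ¬ v ≡ q → Σ (Fin n) λ c → moves c ≡ true × δ S T c v ≡ true
    δ′-p-moving {v} h v≢q with B′.δ⁻ h
    ... | ¬d′pv , u , d′pu , suv with Desc? p v
    ... | inj₁ dpv = ⊥-elim (true≢false (trans (sym suv) (separated-p d′pu (backward-q dpv) v≢q ¬d′pv)))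
    ... | inj₂ ¬dpv with δ⁻ (δ-p⊆δ-q v (δ⁺ ¬dpv (InT′p⇒Desc-p (Desc′-p d′pu)) suv)) | Desc′-p d′pu
    ... | _ , u′ , dqu′ , su′v | kept dpu ¬dqu
      with refl ← unique-neighbour tree (connected Tp) (¬Desc→inT ¬dpv) (Desc→inT dpu)
                    (Desc→inT (Desc-trans (parent-Desc Tq) dqu′)) suv su′v = ⊥-elim (¬dqu dqu′)
    ... | _ | moved mc dcu = _ , mc , δ⁺ (λ dcv → ¬dpv (InT′p⇒Desc-p (moved mc dcv))) dcu suv

    ∣δ′-p∣-no-moving : (∀ c → moves c ≡ false) → ∣δ∣ S T′ p ≤ 1
    ∣δ′-p∣-no-moving none = ≤-trans (#≤suc#─ (δ S T′ p) q)
      (s≤s (≤-reflexive (card-zero _ (allFin n) (All.universal outside-q (allFin n)))))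
      where
      outside-q : ∀ v → (δ S T′ p ─ q) v ≡ false
      outside-q v with (δ S T′ p ─ q) v in h
      ... | false = refl
      ... | true with ∧-true⁻ {δ S T′ p v} h
      ... | δv , v≢q with c , mc , _ ← δ′-p-moving δv (not-≟⁻ v≢q) = ⊥-elim (true≢false (trans (sym mc) (none c)))

    ∣δ′-p∣-moving : ∀ {y} → moves y ≡ true → suc (∣δ∣ S T′ p) ≤ ∣δ∣ S T y
    ∣δ′-p∣-moving {y} my = begin
      suc (∣δ∣ S T′ p)                ≤⟨ s≤s (#≤suc#─ (δ S T′ p) q) ⟩
      suc (suc (# (δ S T′ p ─ q)))    ≤⟨ s≤s (s≤s (card-mono δ′-p─q⊆ (allFin n))) ⟩
      suc (suc (# (δ S T y ─ p ─ q))) ≤⟨ s≤s (suc#─≤# (δ S T y ─ p) q (∧-true⁺ (q∈δ-moving my) (not-≟⁺ (p≢q ∘ sym)))) ⟩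
      suc (# (δ S T y ─ p))           ≤⟨ suc#─≤# (δ S T y) p (p∈δ-moving my) ⟩
      ∣δ∣ S T y                       ∎
      where
      open ≤-Reasoning
      δ′-p─q⊆ : ∀ v → (δ S T′ p ─ q) v ≡ true → (δ S T y ─ p ─ q) v ≡ true
      δ′-p─q⊆ v h with ∧-true⁻ {δ S T′ p v} h
      ... | δv , v≢q with c , mc , δcv ← δ′-p-moving δv (not-≟⁻ v≢q) with refl ← moving-unique mc my =
        ∧-true⁺ (∧-true⁺ δcv (not-≟⁺ λ { refl → proj₁ (B′.δ⁻ δv) D′.self })) v≢q

    ∣δ′-p∣≤ : ∀ {m} → 1 ≤ m → IsKCut S T (suc m) → ∣δ∣ S T′ p ≤ m
    ∣δ′-p∣≤ 1≤m kcut with any? (λ c → moves c ≟ᵇ true)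
    ... | yes (y , my) = ≤-pred (≤-trans (∣δ′-p∣-moving my) (kcut y))
    ... | no none = ≤-trans (∣δ′-p∣-no-moving (λ c → ¬-not (λ mc → none (c , mc)))) 1≤m

lemma9 : {n : ℕ} (S : Fin n → Fin n → Bool) → IsTree S →
         (k : ℕ) → 2 ≤ k →
         (T : Parent n) → IsSTT S T → IsKCut S T k →
         (q p : Fin n) → T q ≡ just p →
         ∣δ∣ S T q ≡ k → ∣δ∣ S T p ≡ k ∸ 1 →
         IsSTT S (rotate S T q p)
         × IsKCut S (rotate S T q p) k
         × ∣δ∣ S (rotate S T q p) q ≤ k ∸ 1
         × (∀ x → ¬ (x ≡ q) → ∣δ∣ S (rotate S T q p) x ≤ ∣δ∣ S T x)
lemma9 S tree (suc (suc k)) (s≤s (s≤s z≤n)) T stt kcut q p Tq ∣δq∣ ∣δp∣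
  with g , Tp ← Boundary.parent-of-boundary S T (proj₁ stt) ∣δp∣ = stt′ , kcut′ , ≤-reflexive ∣δ′q∣ , ∣δ′∣≤∣δ∣
  where
  open Rotation S tree T stt Tq Tp
  ∣δ′q∣ : ∣δ∣ S T′ q ≡ suc k
  ∣δ′q∣ = trans (∣δ∣-cong inT′-q) ∣δp∣
  ∣δ′∣≤∣δ∣ : ∀ x → ¬ x ≡ q → ∣δ∣ S T′ x ≤ ∣δ∣ S T x
  ∣δ′∣≤∣δ∣ x x≢q with x ≟ p
  ... | yes refl = ≤-trans (∣δ′-p∣≤ (δ-p⊆δ-q (≤-reflexive (trans (cong suc ∣δp∣) (sym ∣δq∣)))) (s≤s z≤n) kcut)
                           (≤-reflexive (sym ∣δp∣))
  ... | no x≢p  = ≤-reflexive (∣δ∣-cong (inT′-unchanged x≢p x≢q))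
  kcut′ : IsKCut S T′ (suc (suc k))
  kcut′ x with x ≟ q
  ... | yes refl = m≤n⇒m≤1+n (≤-reflexive ∣δ′q∣)
  ... | no x≢q  = ≤-trans (∣δ′∣≤∣δ∣ x x≢q) (kcut x)
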